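{- Let $G=(V,E)$ be a digraph without self-loops and $S\subseteq V$ such that $G[S]$ is oriented, the maximum total degree in $G[S]$ is $3$, and there is no vertex $u\in S$ for which some $a\in V$ with $(a,u)\in E$ is attacked by no vertex of $S$. Then there exists a vertex in $G[S]$ with in-degree $1$ and out-degree $2$ in $G[S]$.
   Context: An arc $(u,v)$ means $u$ attacks $v$. $G[S]$ denotes the subdigraph induced by $S$; it is oriented if it has no 2-cycles. The total degree of a vertex is its in-degree plus its out-degree. -}

module Defs where

open import Data.Nat using (ℕ; zero; suc; _+_; _≤_)
open import Data.Bool using (Bool; true; false; _∧_; if_then_else_)
open import Data.Fin using (Fin; zero; suc)
open import Data.Fin.Subset using (Subset; _∈_)
open import Data.Vec using (lookup)
open import Data.Product using (_×_; ∃-syntax)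
open import Relation.Binary.PropositionalEquality using (_≡_)
open import Relation.Nullary using (¬_)

-- A finite digraph on vertex set Fin n: arc u v ≡ true means (u , v) ∈ E, i.e. u attacks v.
record Digraph (n : ℕ) : Set where
  field
    arc : Fin n → Fin n → Bool
open Digraph public

count : ∀ {n} → (Fin n → Bool) → ℕ
count {zero}  p = 0
count {suc n} p = (if p zero then 1 else 0) + count (λ i → p (suc i))

Loopless : ∀ {n} → Digraph n → Set
Loopless G = ∀ v → arc G v v ≡ false

inDegIn : ∀ {n} → Digraph n → Subset n → Fin n → ℕ
inDegIn G S v = count (λ u → lookup S u ∧ arc G u v)

outDegIn : ∀ {n} → Digraph n → Subset n → Fin n → ℕ
outDegIn G S v = count (λ w → lookup S w ∧ arc G v w)

totalDegIn : ∀ {n} → Digraph n → Subset n → Fin n → ℕ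
totalDegIn G S v = inDegIn G S v + outDegIn G S v

OrientedIn : ∀ {n} → Digraph n → Subset n → Set
OrientedIn G S = ∀ u v → u ∈ S → v ∈ S → arc G u v ≡ true → arc G v u ≡ false

MaxTotalDegIn : ∀ {n} → Digraph n → Subset n → ℕ → Set
MaxTotalDegIn G S k =
  (∀ v → v ∈ S → totalDegIn G S v ≤ k) × (∃[ v ] (v ∈ S × totalDegIn G S v ≡ k))

DefendsAll : ∀ {n} → Digraph n → Subset n → Set
DefendsAll G S =
  ¬ (∃[ u ] (u ∈ S × ∃[ a ] (arc G a u ≡ true × (∀ s → s ∈ S → arc G s a ≡ false))))

-- Count the arcs of G[S] once at their tails and once at their heads: the out-degrees over S
-- and the in-degrees over S have the same sum. A vertex of S of in-degree 0 has out-degree 0,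
-- for an arc from it into S would be an attack on S that S cannot answer. Hence, if no vertex
-- of S had in-degree 1 and out-degree 2, every vertex of S of total degree at most 3 would
-- have out-degree at most its in-degree, strictly so when its total degree is the odd number 3.
-- A vertex of total degree 3 exists, so the out-degrees would sum to strictly less than the
-- in-degrees.
module Submission where

open import Defs
open import Algebra.Bundles using (CommutativeMonoid)
open import Data.Bool using (Bool; true; false; _∧_; if_then_else_)
open import Data.Bool.Properties using (∧-commutativeMonoid)
open import Data.Nat using (ℕ; zero; suc; _+_; _≤_; _<_; z≤n; s≤s)
open import Data.Nat.Properties
  using (_≟_; +-0-commutativeMonoid; +-suc; +-mono-≤; +-mono-<-≤; +-mono-≤-<; suc-injective;
         m+1+n≢0; m+n≤o⇒n≤o; ≤∧≢⇒<; <⇒≢)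
open import Data.Fin using (Fin; zero; suc)
open import Data.Fin.Properties using (any?)
open import Data.Fin.Subset using (Subset; _∈_)
open import Data.Fin.Subset.Properties using (_∈?_)
open import Data.Vec using (lookup)
open import Data.Vec.Properties using ([]=⇒lookup; lookup⇒[]=)
open import Data.Product using (_×_; ∃-syntax; _,_)
open import Relation.Nullary using (¬_; yes; no; contradiction)
open import Relation.Nullary.Decidable using (_×-dec_)
open import Relation.Binary.PropositionalEquality using (_≡_; _≢_; refl; sym; trans; cong)
open import Algebra.Properties.CommutativeMonoid.Sum +-0-commutativeMonoid
  using (sum; sum-syntax; ∑-comm; sum-cong-≗; sum-replicate-zero)
open import Algebra.Properties.CommutativeSemigroup
  (CommutativeMonoid.commutativeSemigroup ∧-commutativeMonoid)
  using (x∙yz≈y∙xz)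

private
  variable
    n : ℕ

count≡∑ : (p : Fin n → Bool) → count p ≡ ∑[ i < n ] (if p i then 1 else 0)
count≡∑ {zero}  p = refl
count≡∑ {suc n} p = cong ((if p zero then 1 else 0) +_) (count≡∑ (λ i → p (suc i)))

∑-guarded-count : (b : Bool) (p : Fin n → Bool) →
  ∑[ i < n ] (if b ∧ p i then 1 else 0) ≡ (if b then count p else 0)
∑-guarded-count {n} false p = sum-replicate-zero n
∑-guarded-count     true  p = sym (count≡∑ p)

count≢0⇒∃ : (p : Fin n → Bool) → count p ≢ 0 → ∃[ i ] p i ≡ true
count≢0⇒∃ {zero}  p count≢0 = contradiction refl count≢0
count≢0⇒∃ {suc n} p count≢0 with p zero in p0
... | true  = zero , p0
... | false with count≢0⇒∃ (λ i → p (suc i)) count≢0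
...   | i , pi = suc i , pi

count≡0⇒∀ : (p : Fin n → Bool) → count p ≡ 0 → ∀ i → p i ≡ false
count≡0⇒∀ {suc n} p count≡0 i with p zero in p0
count≡0⇒∀ {suc n} p ()      i       | true
count≡0⇒∀ {suc n} p count≡0 zero    | false = p0
count≡0⇒∀ {suc n} p count≡0 (suc i) | false = count≡0⇒∀ (λ j → p (suc j)) count≡0 i

∑-mono-≤ : {f g : Fin n → ℕ} → (∀ i → f i ≤ g i) → sum f ≤ sum g
∑-mono-≤ {zero}  f≤g = z≤n
∑-mono-≤ {suc n} f≤g = +-mono-≤ (f≤g zero) (∑-mono-≤ (λ i → f≤g (suc i)))

∑-mono-< : {f g : Fin n → ℕ} → (∀ i → f i ≤ g i) → (k : Fin n) → f k < g k → sum f < sum g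
∑-mono-< {suc n} f≤g zero    fk<gk = +-mono-<-≤ fk<gk (∑-mono-≤ (λ i → f≤g (suc i)))
∑-mono-< {suc n} f≤g (suc k) fk<gk = +-mono-≤-< (f≤g zero) (∑-mono-< (λ i → f≤g (suc i)) k fk<gk)

∑∈ : Subset n → (Fin n → ℕ) → ℕ
∑∈ {n} S f = ∑[ v < n ] (if lookup S v then f v else 0)

∑∈-mono-< : (S : Subset n) {f g : Fin n → ℕ} → (∀ v → v ∈ S → f v ≤ g v) →
  ∀ {k} → k ∈ S → f k < g k → ∑∈ S f < ∑∈ S g
∑∈-mono-< S {f} {g} f≤g {k} k∈S fk<gk = ∑-mono-< guarded≤ k guardedk<
  where
  guarded≤ : ∀ v → (if lookup S v then f v else 0) ≤ (if lookup S v then g v else 0)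
  guarded≤ v with lookup S v in v∈S
  ... | true  = f≤g v (lookup⇒[]= v S v∈S)
  ... | false = z≤n

  guardedk< : (if lookup S k then f k else 0) < (if lookup S k then g k else 0)
  guardedk< rewrite []=⇒lookup k∈S = fk<gk

∑∈outDegIn≡∑∈inDegIn : (G : Digraph n) (S : Subset n) →
  ∑∈ S (outDegIn G S) ≡ ∑∈ S (inDegIn G S)
∑∈outDegIn≡∑∈inDegIn {n} G S = begin
  ∑∈ S (outDegIn G S)
    ≡⟨ sum-cong-≗ (λ u → ∑-guarded-count (s u) (λ v → s v ∧ arc G u v)) ⟨
  ∑[ u < n ] ∑[ v < n ] (if s u ∧ (s v ∧ arc G u v) then 1 else 0)
    ≡⟨ ∑-comm (λ u v → if s u ∧ (s v ∧ arc G u v) then 1 else 0) ⟩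
  ∑[ v < n ] ∑[ u < n ] (if s u ∧ (s v ∧ arc G u v) then 1 else 0)
    ≡⟨ sum-cong-≗ (λ v → sum-cong-≗ (λ u →
         cong (if_then 1 else 0) (x∙yz≈y∙xz (s u) (s v) (arc G u v)))) ⟩
  ∑[ v < n ] ∑[ u < n ] (if s v ∧ (s u ∧ arc G u v) then 1 else 0)
    ≡⟨ sum-cong-≗ (λ v → ∑-guarded-count (s v) (λ u → s u ∧ arc G u v)) ⟩
  ∑∈ S (inDegIn G S) ∎
  where
  open Relation.Binary.PropositionalEquality.≡-Reasoning
  s = lookup S

∧≡true⇒× : ∀ {x y} → x ∧ y ≡ true → x ≡ true × y ≡ true
∧≡true⇒× {true}  {true}  refl = refl , refl
∧≡true⇒× {true}  {false} ()
∧≡true⇒× {false}         ()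

inDegIn≡0⇒outDegIn≡0 : (G : Digraph n) (S : Subset n) → DefendsAll G S →
  ∀ {v} → inDegIn G S v ≡ 0 → outDegIn G S v ≡ 0
inDegIn≡0⇒outDegIn≡0 G S defends {v} in≡0 with outDegIn G S v ≟ 0
... | yes out≡0 = out≡0
... | no  out≢0 with count≢0⇒∃ (λ w → lookup S w ∧ arc G v w) out≢0
...   | w , w∈S∧v→w with ∧≡true⇒× w∈S∧v→w
...     | w∈S , v→w = contradiction (w , lookup⇒[]= w S w∈S , v , v→w , unattacked) defends
  where
  unattacked : ∀ t → t ∈ S → arc G t v ≡ false
  unattacked t t∈S with count≡0⇒∀ (λ u → lookup S u ∧ arc G u v) in≡0 t
  ... | t∉S∨¬t→v rewrite []=⇒lookup t∈S = t∉S∨¬t→v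

out≤in : ∀ i o → i + o ≤ 3 → (i ≡ 0 → o ≡ 0) → ¬ (i ≡ 1 × o ≡ 2) → o ≤ i
out≤in i             0                   _         _    _     = z≤n
out≤in 0             (suc o)             _         src  _     = contradiction (src refl) λ ()
out≤in (suc i)       1                   _         _    _     = s≤s z≤n
out≤in 1             2                   _         _    not12 = contradiction (refl , refl) not12
out≤in (suc (suc i)) 2                   _         _    _     = s≤s (s≤s z≤n)
out≤in (suc i)       (suc (suc (suc o))) (s≤s tot) _    _     =
  contradiction (m+n≤o⇒n≤o i tot) λ { (s≤s (s≤s ())) }

m+m≢3 : ∀ m → m + m ≢ 3
m+m≢3 0             ()
m+m≢3 1             ()
m+m≢3 (suc (suc m)) eq =
  m+1+n≢0 m (suc-injective (trans (sym (+-suc m (suc m))) (suc-injective (suc-injective eq))))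

out≤in⇒out<in : ∀ i o → i + o ≡ 3 → o ≤ i → o < i
out≤in⇒out<in i o tot o≤i = ≤∧≢⇒< o≤i λ { refl → m+m≢3 o tot }

mainTheorem18 : (n : ℕ) (G : Digraph n) (S : Subset n) →
    Loopless G → OrientedIn G S → MaxTotalDegIn G S 3 → DefendsAll G S →
    ∃[ v ] (v ∈ S × inDegIn G S v ≡ 1 × outDegIn G S v ≡ 2)
mainTheorem18 n G S _ _ (deg≤3 , k , k∈S , degk≡3) defends
  with any? (λ v → v ∈? S ×-dec (inDegIn G S v ≟ 1 ×-dec outDegIn G S v ≟ 2))
... | yes found = found
... | no  none  =
  contradiction (∑∈outDegIn≡∑∈inDegIn G S) (<⇒≢ (∑∈-mono-< S out≤in-S k∈S outk<ink))
  where
  out≤in-S : ∀ v → v ∈ S → outDegIn G S v ≤ inDegIn G S v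
  out≤in-S v v∈S = out≤in _ _ (deg≤3 v v∈S) (inDegIn≡0⇒outDegIn≡0 G S defends)
    λ { (in≡1 , out≡2) → none (v , v∈S , in≡1 , out≡2) }

  outk<ink : outDegIn G S k < inDegIn G S k
  outk<ink = out≤in⇒out<in _ _ degk≡3 (out≤in-S k k∈S)
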